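{- Let $k\ge 2$, let $e=(v,w)$ be an edge, and let $f_{\mathrm{start}}\colon\{v,w\}\to[k]$ be a proper $k$-coloring of it (i.e., $f_{\mathrm{start}}(v)\ne f_{\mathrm{start}}(w)$). Let $F\colon\{v,w\}\to[k]$ be a uniformly random $k$-coloring and let $\mathscr F$ be chosen uniformly at random from $\mathbb F(f_{\mathrm{start}}\leftrightsquigarrow F)$. Then $$\Pr\bigl[\forall f\in\mathscr F:\ f(v)\ne f(w)\bigr]\ge\Bigl(1-\tfrac1k\Bigr)^2.$$
   Context: A reconfiguration sequence $(f^{(1)},\dots,f^{(T)})$ from $f_1$ to $f_2$ is a sequence of colorings from $f_1$ to $f_2$ with consecutive members differing on at most one vertex; it is irredundant if no two adjacent colorings are identical and for each vertex $u$ there is $t^*$ with $f^{(t)}(u)=f_1(u)$ for $t\le t^*$ and $f^{(t)}(u)=f_2(u)$ for $t>t^*$. $\mathbb F(f_1\leftrightsquigarrow f_2)$ denotes the set of all irredundant reconfiguration sequences from $f_1$ to $f_2$. -}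

module Defs where

open import Data.Nat using (ℕ; zero; suc; _<_; _≤_; _*_)
open import Data.Fin using (Fin; toℕ)
open import Data.Fin.Patterns using (0F; 1F)
open import Data.Vec using (Vec; lookup; _∷_; [])
open import Data.List using (List; []; _∷_; length; head; last; allFin; concatMap; map; filter; foldr)
open import Data.List.Relation.Unary.All using (All; all?)
open import Data.List.Relation.Unary.Linked using (Linked)
open import Data.Maybe using (just)
open import Data.Product using (Σ; ∃; _×_; _,_)
open import Data.Integer using (+_)
open import Data.Rational using (ℚ; 0ℚ; _/_; _+_)
open import Relation.Binary.PropositionalEquality using (_≡_; _≢_)
open import Relation.Nullary using (¬_; Dec)
open import Relation.Nullary using (¬?)
import Data.Fin.Properties as FinP

-- The graph is a single edge e = (v , w); vertices are Fin 2 with v = 0F, w = 1F.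
-- A k-coloring of {v,w} (not necessarily proper) is a vector of two colors in [k] = Fin k.
Col : ℕ → Set
Col k = Vec (Fin k) 2

Proper : ∀ {k} → Col k → Set
Proper f = lookup f 0F ≢ lookup f 1F

proper? : ∀ {k} (f : Col k) → Dec (Proper f)
proper? f = ¬? (lookup f 0F FinP.≟ lookup f 1F)

DiffAtMostOne : ∀ {k} → Col k → Col k → Set
DiffAtMostOne g h = ∃ λ (u : Fin 2) → ∀ (u' : Fin 2) → u' ≢ u → lookup g u' ≡ lookup h u'

Step : ∀ {k} → Col k → Col k → Set
Step g h = DiffAtMostOne g h × g ≢ h

-- A sequence (f^(1), ..., f^(T)) is a list; index i : Fin T corresponds to t = i + 1.
-- Irredundant reconfiguration sequence from f1 to f2.
IsIrredundant : ∀ {k} → Col k → Col k → List (Col k) → Set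
IsIrredundant f1 f2 s =
  head s ≡ just f1 × last s ≡ just f2 × Linked Step s ×
  (∀ (u : Fin 2) → Σ ℕ λ tstar → tstar ≤ length s ×
     (∀ (i : Fin (length s)) →
        (toℕ i < tstar → lookup (Data.List.lookup s i) u ≡ lookup f1 u) ×
        (tstar ≤ toℕ i → lookup (Data.List.lookup s i) u ≡ lookup f2 u)))

AllProper : ∀ {k} → List (Col k) → Set
AllProper s = All Proper s

allProper? : ∀ {k} (s : List (Col k)) → Dec (AllProper s)
allProper? s = all? proper? s

allCol : ∀ k → List (Col k)
allCol k = concatMap (λ a → map (λ b → a ∷ b ∷ []) (allFin k)) (allFin k)

-- the rational a / b (only ever used with b > 0; returns 0 if b = 0)
frac : ℕ → ℕ → ℚ
frac a zero = 0ℚ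
frac a (suc b) = (+ a) / suc b

sumℚ : List ℚ → ℚ
sumℚ = foldr _+_ 0ℚ

-- Given, for each target coloring F, an enumeration (duplicate-free list) of the finite
-- set 𝔽(f_start ⇝ F), the probability that a uniformly random F and a uniformly random
-- sequence in 𝔽(f_start ⇝ F) keep e properly colored throughout.
probAllProper : ∀ k → (enum : Col k → List (List (Col k))) → ℚ
probAllProper k enum =
  Data.Rational._*_ (frac 1 (k * k))
    (sumℚ (map (λ F → frac (length (filter allProper? (enum F))) (length (enum F))) (allCol k)))

-- An irredundant sequence recolours each of v, w at most once, so towards a target (c , d) it
-- is either trivial, a single recolouring, or one of the two orders "v then w" (through
-- (c , b)) and "w then v" (through (a , d)). The first stays proper iff c ∉ {b , d}, the
-- second iff d ∉ {a , c}. Averaging over the at most two sequences, the probability for a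
-- fixed target is at least half the number of proper orders, and each order is proper for
-- exactly (k - 1)² of the k² targets; so the total is at least (k - 1)² / k².
module Submission where

open import Defs
open import Data.Nat as ℕ using (ℕ; zero; suc; _≤_; _<_; z≤n; s≤s)
import Data.Nat.Properties as ℕ
open import Data.Nat.ListAction using (sum)
open import Data.Nat.ListAction.Properties using (sum-++)
open import Data.Nat.Solver using (module +-*-Solver)
open import Data.Integer as ℤ using (+_; +≤+)
import Data.Integer.Properties as ℤ
open import Data.Rational as ℚ using (ℚ; 1ℚ; _-_; _*_; toℚᵘ) renaming (_≤_ to _≤ℚ_)
import Data.Rational.Properties as ℚ
import Data.Rational.Solver
open import Data.Rational.Unnormalised as ℚᵘ using (mkℚᵘ; *≡*; *≤*)
import Data.Rational.Unnormalised.Properties as ℚᵘ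
open import Data.Fin as Fin using (Fin; toℕ; punchIn)
open import Data.Fin.Patterns using (0F; 1F; 2F; 3F)
import Data.Fin.Properties as Fin
open import Data.Vec using (lookup; _∷_; [])
open import Data.Vec.Properties using (∷-injectiveˡ; ∷-injectiveʳ)
open import Data.List as List using (List; []; _∷_; map; length; filter; allFin; tabulate; concatMap)
import Data.List.Properties as List
open import Data.List.Relation.Unary.All as All using (All; []; _∷_)
open import Data.List.Relation.Unary.Linked using ([-]; _∷_)
open import Data.List.Relation.Unary.AllPairs using (_∷_)
open import Data.List.Membership.Propositional using (_∈_)
open import Data.List.Membership.Propositional.Properties using (∈-filter⁺)
open import Data.List.Relation.Unary.Unique.Propositional using (Unique)
open import Data.Product using (∃; _×_; _,_; proj₁; proj₂)
open import Data.Sum using (_⊎_; inj₁; inj₂; swap)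
open import Data.Empty using (⊥; ⊥-elim)
open import Relation.Nullary using (Dec; yes; no; ¬_; ¬?; _×-dec_)
open import Relation.Nullary.Decidable using (decidable-stable)
open import Relation.Binary.PropositionalEquality
open import Function using (_∘_)
open import Function.Bundles using (_⇔_; Equivalence)
open import Algebra.Properties.CommutativeMonoid.Sum ℕ.+-0-commutativeMonoid
  using (sum-syntax; sum-cong-≗; sum-remove; ∑-distrib-+; ∑-comm)
open import Algebra.Properties.Semiring.Sum ℕ.+-*-semiring using (*-distribˡ-sum; *-distribʳ-sum)

open +-*-Solver
module ℚ-Solver = Data.Rational.Solver.+-*-Solver

toℚᵘ-frac : ∀ a n → toℚᵘ (frac a (suc n)) ℚᵘ.≃ mkℚᵘ (+ a) n
toℚᵘ-frac a n = ℚ.toℚᵘ-fromℚᵘ (mkℚᵘ (+ a) n)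

frac-≤ : ∀ a m b n → 0 < m → 0 < n → a ℕ.* n ≤ b ℕ.* m → frac a m ≤ℚ frac b n
frac-≤ a (suc m) b (suc n) _ _ an≤bm = ℚ.toℚᵘ-cancel-≤
  (ℚᵘ.≤-respˡ-≃ (ℚᵘ.≃-sym (toℚᵘ-frac a m)) (ℚᵘ.≤-respʳ-≃ (ℚᵘ.≃-sym (toℚᵘ-frac b n))
    (*≤* (subst₂ ℤ._≤_ (ℤ.pos-* a (suc n)) (ℤ.pos-* b (suc m)) (+≤+ an≤bm)))))

frac-≡ : ∀ a m b n → 0 < m → 0 < n → a ℕ.* n ≡ b ℕ.* m → frac a m ≡ frac b n
frac-≡ a m b n 0<m 0<n eq =
  ℚ.≤-antisym (frac-≤ a m b n 0<m 0<n (ℕ.≤-reflexive eq)) (frac-≤ b n a m 0<n 0<m (ℕ.≤-reflexive (sym eq)))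

frac-+ : ∀ a b n → frac a (suc n) ℚ.+ frac b (suc n) ≡ frac (a ℕ.+ b) (suc n)
frac-+ a b n = ℚ.toℚᵘ-injective (ℚᵘ.≃-trans (ℚ.toℚᵘ-homo-+ (frac a d) (frac b d))
  (ℚᵘ.≃-trans (ℚᵘ.+-cong (toℚᵘ-frac a n) (toℚᵘ-frac b n))
  (ℚᵘ.≃-trans (*≡* cross) (ℚᵘ.≃-sym (toℚᵘ-frac (a ℕ.+ b) n)))))
  where
  d : ℕ
  d = suc n
  cross : (+ a ℤ.* + d ℤ.+ + b ℤ.* + d) ℤ.* + d ≡ + (a ℕ.+ b) ℤ.* + (d ℕ.* d)
  cross = begin
    (+ a ℤ.* + d ℤ.+ + b ℤ.* + d) ℤ.* + d  ≡⟨ cong (ℤ._* + d) (cong₂ ℤ._+_ (ℤ.pos-* a d) (ℤ.pos-* b d)) ⟨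
    (+ (a ℕ.* d) ℤ.+ + (b ℕ.* d)) ℤ.* + d  ≡⟨ cong (ℤ._* + d) (ℤ.pos-+ (a ℕ.* d) (b ℕ.* d)) ⟨
    + (a ℕ.* d ℕ.+ b ℕ.* d) ℤ.* + d        ≡⟨ ℤ.pos-* (a ℕ.* d ℕ.+ b ℕ.* d) d ⟨
    + ((a ℕ.* d ℕ.+ b ℕ.* d) ℕ.* d)        ≡⟨ cong +_ (solve 3 (λ a b d → (a :* d :+ b :* d) :* d := (a :+ b) :* (d :* d)) refl a b d) ⟩
    + ((a ℕ.+ b) ℕ.* (d ℕ.* d))            ≡⟨ ℤ.pos-* (a ℕ.+ b) (d ℕ.* d) ⟩
    + (a ℕ.+ b) ℤ.* + (d ℕ.* d)            ∎
    where open ≡-Reasoning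

frac-* : ∀ a b m n → frac a (suc m) * frac b (suc n) ≡ frac (a ℕ.* b) (suc m ℕ.* suc n)
frac-* a b m n = ℚ.toℚᵘ-injective (ℚᵘ.≃-trans (ℚ.toℚᵘ-homo-* (frac a (suc m)) (frac b (suc n)))
  (ℚᵘ.≃-trans (ℚᵘ.*-cong (toℚᵘ-frac a m) (toℚᵘ-frac b n))
  (ℚᵘ.≃-trans (*≡* (cong (ℤ._* + (suc m ℕ.* suc n)) (sym (ℤ.pos-* a b))))
    (ℚᵘ.≃-sym (toℚᵘ-frac (a ℕ.* b) (n ℕ.+ m ℕ.* suc n))))))

1-frac : ∀ n → 1ℚ - frac 1 (suc n) ≡ frac n (suc n)
1-frac n = begin
  1ℚ - y         ≡⟨ cong (_- y) whole ⟨
  (x ℚ.+ y) - y  ≡⟨ ℚ-Solver.solve 2 (λ x y → (x ℚ-Solver.:+ y) ℚ-Solver.:- y ℚ-Solver.:= x) refl x y ⟩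
  x              ∎
  where
  open ≡-Reasoning
  x y : ℚ
  x = frac n (suc n)
  y = frac 1 (suc n)
  whole : x ℚ.+ y ≡ 1ℚ
  whole = trans (frac-+ n 1 n)
    (frac-≡ (n ℕ.+ 1) (suc n) 1 1 (s≤s z≤n) (s≤s z≤n) (solve 1 (λ n → (n :+ con 1) :* con 1 := con 1 :* (con 1 :+ n)) refl n))

complement-square : ∀ n → (1ℚ - frac 1 (suc n)) * (1ℚ - frac 1 (suc n)) ≡ frac 1 (suc n ℕ.* suc n) * frac (n ℕ.* n ℕ.+ n ℕ.* n) 2
complement-square n = begin
  (1ℚ - frac 1 k) * (1ℚ - frac 1 k)                   ≡⟨ cong₂ _*_ (1-frac n) (1-frac n) ⟩
  frac n k * frac n k                                 ≡⟨ frac-* n n n n ⟩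
  frac (n ℕ.* n) (k ℕ.* k)                            ≡⟨ frac-≡ (n ℕ.* n) (k ℕ.* k) (1 ℕ.* two-n²) (k ℕ.* k ℕ.* 2) (s≤s z≤n) (s≤s z≤n)
                                                          (solve 2 (λ n k → (n :* n) :* (k :* k :* con 2) := con 1 :* (n :* n :+ n :* n) :* (k :* k)) refl n k) ⟩
  frac (1 ℕ.* two-n²) (k ℕ.* k ℕ.* 2)                 ≡⟨ frac-* 1 two-n² (n ℕ.+ n ℕ.* k) 1 ⟨
  frac 1 (k ℕ.* k) * frac two-n² 2                    ∎
  where
  open ≡-Reasoning
  k two-n² : ℕ
  k = suc n
  two-n² = n ℕ.* n ℕ.+ n ℕ.* n

sumℚ-mono : ∀ {A : Set} {f g : A → ℚ} (xs : List A) → (∀ x → f x ≤ℚ g x) → sumℚ (map f xs) ≤ℚ sumℚ (map g xs)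
sumℚ-mono []       f≤g = ℚ.≤-refl
sumℚ-mono (x ∷ xs) f≤g = ℚ.+-mono-≤ (f≤g x) (sumℚ-mono xs f≤g)

sumℚ-frac : ∀ {A : Set} (h : A → ℕ) n (xs : List A) →
  sumℚ (map (λ x → frac (h x) (suc n)) xs) ≡ frac (sum (map h xs)) (suc n)
sumℚ-frac h n []       = frac-≡ 0 1 0 (suc n) (s≤s z≤n) (s≤s z≤n) refl
sumℚ-frac h n (x ∷ xs) = trans (cong (frac (h x) (suc n) ℚ.+_) (sumℚ-frac h n xs)) (frac-+ (h x) _ n)

𝟙 : ∀ {p} {P : Set p} → Dec P → ℕ
𝟙 (yes _) = 1
𝟙 (no _)  = 0

𝟙-yes : ∀ {p} {P : Set p} (P? : Dec P) → P → 𝟙 P? ≡ 1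
𝟙-yes (yes _) _  = refl
𝟙-yes (no ¬p) p = ⊥-elim (¬p p)

𝟙-no : ∀ {p} {P : Set p} (P? : Dec P) → ¬ P → 𝟙 P? ≡ 0
𝟙-no (yes p) ¬p = ⊥-elim (¬p p)
𝟙-no (no _)  _  = refl

𝟙-× : ∀ {p q} {P : Set p} {Q : Set q} (P? : Dec P) (Q? : Dec Q) → 𝟙 (P? ×-dec Q?) ≡ 𝟙 P? ℕ.* 𝟙 Q?
𝟙-× (yes _) (yes _) = refl
𝟙-× (yes _) (no _)  = refl
𝟙-× (no _)  _       = refl

∑-const-1 : ∀ n → ∑[ _ < n ] 1 ≡ n
∑-const-1 zero    = refl
∑-const-1 (suc n) = cong suc (∑-const-1 n)

∑-ones-except : ∀ {n} (y : Fin (suc n)) (f : Fin (suc n) → ℕ) →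
  f y ≡ 0 → (∀ x → x ≢ y → f x ≡ 1) → ∑[ x < suc n ] f x ≡ n
∑-ones-except {n} y f fy≡0 f≡1 = begin
  ∑[ x < suc n ] f x                ≡⟨ sum-remove {i = y} f ⟩
  f y ℕ.+ ∑[ j < n ] f (punchIn y j) ≡⟨ cong₂ ℕ._+_ fy≡0 (sum-cong-≗ (λ j → f≡1 _ (Fin.punchInᵢ≢i y j))) ⟩
  ∑[ _ < n ] 1                      ≡⟨ ∑-const-1 n ⟩
  n                                 ∎
  where open ≡-Reasoning

_≢?_ : ∀ {k} (x y : Fin k) → Dec (x ≢ y)
x ≢? y = ¬? (x Fin.≟ y)

∑-≢ˡ : ∀ {n} (y : Fin (suc n)) → ∑[ x < suc n ] 𝟙 (x ≢? y) ≡ n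
∑-≢ˡ y = ∑-ones-except y _ (𝟙-no (y ≢? y) (λ y≢y → y≢y refl)) (λ x → 𝟙-yes (x ≢? y))

∑-≢ʳ : ∀ {n} (x : Fin (suc n)) → ∑[ z < suc n ] 𝟙 (x ≢? z) ≡ n
∑-≢ʳ x = ∑-ones-except x _ (𝟙-no (x ≢? x) (λ x≢x → x≢x refl)) (λ z z≢x → 𝟙-yes (x ≢? z) (≢-sym z≢x))

Avoids : ∀ {k} → Fin k → Fin k → Fin k → Set
Avoids x y z = x ≢ y × x ≢ z

avoids? : ∀ {k} (x y z : Fin k) → Dec (Avoids x y z)
avoids? x y z = (x ≢? y) ×-dec (x ≢? z)

∑∑-avoids : ∀ {n} (y : Fin (suc n)) → ∑[ x < suc n ] ∑[ z < suc n ] 𝟙 (avoids? x y z) ≡ n ℕ.* n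
∑∑-avoids {n} y = begin
  ∑[ x < suc n ] ∑[ z < suc n ] 𝟙 (avoids? x y z)          ≡⟨ sum-cong-≗ (λ x → sum-cong-≗ (λ z → 𝟙-× (x ≢? y) (x ≢? z))) ⟩
  ∑[ x < suc n ] ∑[ z < suc n ] (𝟙 (x ≢? y) ℕ.* 𝟙 (x ≢? z))  ≡⟨ sum-cong-≗ (λ x → *-distribˡ-sum (𝟙 (x ≢? y)) (λ z → 𝟙 (x ≢? z))) ⟨
  ∑[ x < suc n ] (𝟙 (x ≢? y) ℕ.* ∑[ z < suc n ] 𝟙 (x ≢? z))  ≡⟨ sum-cong-≗ (λ x → cong (𝟙 (x ≢? y) ℕ.*_) (∑-≢ʳ x)) ⟩
  ∑[ x < suc n ] (𝟙 (x ≢? y) ℕ.* n)                       ≡⟨ *-distribʳ-sum n (λ x → 𝟙 (x ≢? y)) ⟨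
  (∑[ x < suc n ] 𝟙 (x ≢? y)) ℕ.* n                       ≡⟨ cong (ℕ._* n) (∑-≢ˡ y) ⟩
  n ℕ.* n                                                 ∎
  where open ≡-Reasoning

sum-concatMap : ∀ {A : Set} (f : A → List ℕ) (xs : List A) → sum (concatMap f xs) ≡ sum (map (sum ∘ f) xs)
sum-concatMap f []       = refl
sum-concatMap f (x ∷ xs) = trans (sum-++ (f x) (concatMap f xs)) (cong (sum (f x) ℕ.+_) (sum-concatMap f xs))

sum-tabulate : ∀ {n} (f : Fin n → ℕ) → sum (tabulate f) ≡ ∑[ i < n ] f i
sum-tabulate {zero}  f = refl
sum-tabulate {suc n} f = cong (f Fin.zero ℕ.+_) (sum-tabulate (f ∘ Fin.suc))

sum-map-allFin : ∀ {n} (f : Fin n → ℕ) → sum (map f (allFin n)) ≡ ∑[ i < n ] f i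
sum-map-allFin {n} f = trans (cong sum (List.map-tabulate (λ i → i) f)) (sum-tabulate f)

sum-allCol : ∀ {k} (h : Col k → ℕ) → sum (map h (allCol k)) ≡ ∑[ c < k ] ∑[ d < k ] h (c ∷ d ∷ [])
sum-allCol {k} h = begin
  sum (map h (concatMap row (allFin k)))             ≡⟨ cong sum (List.map-concatMap h row (allFin k)) ⟩
  sum (concatMap (map h ∘ row) (allFin k))           ≡⟨ sum-concatMap (map h ∘ row) (allFin k) ⟩
  sum (map (λ c → sum (map h (row c))) (allFin k))   ≡⟨ sum-map-allFin (λ c → sum (map h (row c))) ⟩
  ∑[ c < k ] sum (map h (row c))                     ≡⟨ sum-cong-≗ (λ c → cong sum (List.map-∘ {g = h} {f = λ d → c ∷ d ∷ []} (allFin k))) ⟨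
  ∑[ c < k ] sum (map (λ d → h (c ∷ d ∷ [])) (allFin k)) ≡⟨ sum-cong-≗ (λ c → sum-map-allFin (λ d → h (c ∷ d ∷ []))) ⟩
  ∑[ c < k ] ∑[ d < k ] h (c ∷ d ∷ [])               ∎
  where
  open ≡-Reasoning
  row : Fin k → List (Col k)
  row c = map (λ d → c ∷ d ∷ []) (allFin k)

Col-≡ : ∀ {k} {x y : Col k} → lookup x 0F ≡ lookup y 0F → lookup x 1F ≡ lookup y 1F → x ≡ y
Col-≡ {x = _ ∷ _ ∷ []} {_ ∷ _ ∷ []} = cong₂ (λ p q → p ∷ q ∷ [])

Threshold : ∀ {k} → Col k → Col k → List (Col k) → Fin 2 → ℕ → Set
Threshold f g s u t = ∀ (i : Fin (length s)) →
  (toℕ i < t → lookup (List.lookup s i) u ≡ lookup f u) × (t ≤ toℕ i → lookup (List.lookup s i) u ≡ lookup g u)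

unchanged-off-threshold : ∀ {A : Set} {p q x y : A} t i j → j ≡ suc i →
  (i < t → x ≡ p) × (t ≤ i → x ≡ q) → (j < t → y ≡ p) × (t ≤ j → y ≡ q) → t ≢ j → x ≡ y
unchanged-off-threshold t i _ refl (x≡p , x≡q) (y≡p , y≡q) t≢1+i with t ℕ.≤? i
... | yes t≤i = trans (x≡q t≤i) (sym (y≡q (ℕ.m≤n⇒m≤1+n t≤i)))
... | no t≰i  = trans (x≡p (ℕ.≰⇒> t≰i)) (sym (y≡p (ℕ.≤∧≢⇒< (ℕ.≰⇒> t≰i) (≢-sym t≢1+i))))

step-crosses-threshold : ∀ {k} {f g : Col k} {s} {tv tw} →
  Threshold f g s 0F tv → Threshold f g s 1F tw → (i j : Fin (length s)) → toℕ j ≡ suc (toℕ i) →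
  List.lookup s i ≢ List.lookup s j → tv ≡ toℕ j ⊎ tw ≡ toℕ j
step-crosses-threshold {tv = tv} {tw} Pv Pw i j j≡1+i changed with tv ℕ.≟ toℕ j | tw ℕ.≟ toℕ j
... | yes tv≡j | _        = inj₁ tv≡j
... | no _     | yes tw≡j = inj₂ tw≡j
... | no tv≢j  | no tw≢j  = ⊥-elim (changed (Col-≡
  (unchanged-off-threshold tv (toℕ i) (toℕ j) j≡1+i (Pv i) (Pv j) tv≢j)
  (unchanged-off-threshold tw (toℕ i) (toℕ j) j≡1+i (Pw i) (Pw j) tw≢j)))

vFirst wFirst : ∀ {k} (a b c d : Fin k) → List (Col k)
vFirst a b c d = (a ∷ b ∷ []) ∷ (c ∷ b ∷ []) ∷ (c ∷ d ∷ []) ∷ []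
wFirst a b c d = (a ∷ b ∷ []) ∷ (a ∷ d ∷ []) ∷ (c ∷ d ∷ []) ∷ []

data Route {k} : Col k → Col k → List (Col k) → Set where
  stay      : ∀ {f} → Route f f (f ∷ [])
  direct    : ∀ {f g} → DiffAtMostOne f g → Route f g (f ∷ g ∷ [])
  by-vFirst : ∀ {a b c d} → Route (a ∷ b ∷ []) (c ∷ d ∷ []) (vFirst a b c d)
  by-wFirst : ∀ {a b c d} → Route (a ∷ b ∷ []) (c ∷ d ∷ []) (wFirst a b c d)

two-step-route : ∀ {k} {a b c d : Fin k} {y : Col k} tv tw →
  Threshold (a ∷ b ∷ []) (c ∷ d ∷ []) ((a ∷ b ∷ []) ∷ y ∷ (c ∷ d ∷ []) ∷ []) 0F tv →
  Threshold (a ∷ b ∷ []) (c ∷ d ∷ []) ((a ∷ b ∷ []) ∷ y ∷ (c ∷ d ∷ []) ∷ []) 1F tw →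
  (a ∷ b ∷ []) ≢ y → y ≢ (c ∷ d ∷ []) → Route (a ∷ b ∷ []) (c ∷ d ∷ []) ((a ∷ b ∷ []) ∷ y ∷ (c ∷ d ∷ []) ∷ [])
two-step-route {k} {a} {b} {c} {d} {y} tv tw Pv Pw st₁ st₂ =
  from-crossings (crossing 0F 1F refl st₁) (crossing 1F 2F refl st₂)
  where
  s : List (Col k)
  s = (a ∷ b ∷ []) ∷ y ∷ (c ∷ d ∷ []) ∷ []
  crossing : (i j : Fin 3) → toℕ j ≡ suc (toℕ i) → List.lookup s i ≢ List.lookup s j → tv ≡ toℕ j ⊎ tw ≡ toℕ j
  crossing = step-crosses-threshold {f = a ∷ b ∷ []} {c ∷ d ∷ []} Pv Pw
  from-crossings : tv ≡ 1 ⊎ tw ≡ 1 → tv ≡ 2 ⊎ tw ≡ 2 → Route (a ∷ b ∷ []) (c ∷ d ∷ []) s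
  from-crossings (inj₁ refl) (inj₁ ())
  from-crossings (inj₂ refl) (inj₂ ())
  from-crossings (inj₁ refl) (inj₂ refl) =
    subst (λ y → Route _ _ (_ ∷ y ∷ _ ∷ [])) (sym (Col-≡ (proj₂ (Pv 1F) ℕ.≤-refl) (proj₁ (Pw 1F) ℕ.≤-refl))) by-vFirst
  from-crossings (inj₂ refl) (inj₁ refl) =
    subst (λ y → Route _ _ (_ ∷ y ∷ _ ∷ [])) (sym (Col-≡ (proj₁ (Pv 1F) ℕ.≤-refl) (proj₂ (Pw 1F) ℕ.≤-refl))) by-wFirst

no-three-crossings : ∀ {tv tw : ℕ} → tv ≡ 1 ⊎ tw ≡ 1 → tv ≡ 2 ⊎ tw ≡ 2 → ¬ (tv ≡ 3 ⊎ tw ≡ 3)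
no-three-crossings (inj₁ refl) (inj₁ ())
no-three-crossings (inj₂ refl) (inj₂ ())
no-three-crossings (inj₁ refl) (inj₂ refl) (inj₁ ())
no-three-crossings (inj₁ refl) (inj₂ refl) (inj₂ ())
no-three-crossings (inj₂ refl) (inj₁ refl) (inj₁ ())
no-three-crossings (inj₂ refl) (inj₁ refl) (inj₂ ())

irredundant⇒Route : ∀ {k} {f g : Col k} {s} → IsIrredundant f g s → Route f g s
irredundant⇒Route {f = _ ∷ _ ∷ []} {_ ∷ _ ∷ []} {[]} (() , _)
irredundant⇒Route {f = _ ∷ _ ∷ []} {_ ∷ _ ∷ []} {_ ∷ []} (refl , refl , _) = stay
irredundant⇒Route {f = _ ∷ _ ∷ []} {_ ∷ _ ∷ []} {_ ∷ _ ∷ []} (refl , refl , (st ∷ _) , _) = direct (proj₁ st)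
irredundant⇒Route {f = _ ∷ _ ∷ []} {_ ∷ _ ∷ []} {_ ∷ _ ∷ _ ∷ []} (refl , refl , (st₁ ∷ st₂ ∷ _) , ts) =
  two-step-route _ _ (proj₂ (proj₂ (ts 0F))) (proj₂ (proj₂ (ts 1F))) (proj₂ st₁) (proj₂ st₂)
irredundant⇒Route {f = f@(_ ∷ _ ∷ [])} {g@(_ ∷ _ ∷ [])} {s@(_ ∷ _ ∷ _ ∷ _ ∷ _)} (_ , _ , (st₁ ∷ st₂ ∷ st₃ ∷ _) , ts)
  with ts 0F | ts 1F
... | tv , _ , Pv | tw , _ , Pw =
  ⊥-elim (no-three-crossings (crossing 0F 1F refl (proj₂ st₁)) (crossing 1F 2F refl (proj₂ st₂)) (crossing 2F 3F refl (proj₂ st₃)))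
  where
  crossing : (i j : Fin (length s)) → toℕ j ≡ suc (toℕ i) → List.lookup s i ≢ List.lookup s j → tv ≡ toℕ j ⊎ tw ≡ toℕ j
  crossing = step-crosses-threshold {f = f} {g} Pv Pw

route-allProper : ∀ {k} {a b c d : Fin k} {s} → Route (a ∷ b ∷ []) (c ∷ d ∷ []) s →
  a ≢ b → Avoids c b d → Avoids d a c → AllProper s
route-allProper stay          a≢b _             _         = a≢b ∷ []
route-allProper (direct _)    a≢b (_ , c≢d)     _         = a≢b ∷ c≢d ∷ []
route-allProper by-vFirst     a≢b (c≢b , c≢d)   _         = a≢b ∷ c≢b ∷ c≢d ∷ []
route-allProper by-wFirst     a≢b (_ , c≢d)     (d≢a , _) = a≢b ∷ ≢-sym d≢a ∷ c≢d ∷ []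

both-recoloured⇒two-step : ∀ {k} {a b c d : Fin k} {s} → a ≢ c → b ≢ d →
  Route (a ∷ b ∷ []) (c ∷ d ∷ []) s → s ≡ vFirst a b c d ⊎ s ≡ wFirst a b c d
both-recoloured⇒two-step a≢c _   stay                 = ⊥-elim (a≢c refl)
both-recoloured⇒two-step _   b≢d (direct (0F , same)) = ⊥-elim (b≢d (same 1F (λ ())))
both-recoloured⇒two-step a≢c _   (direct (1F , same)) = ⊥-elim (a≢c (same 0F (λ ())))
both-recoloured⇒two-step _   _   by-vFirst            = inj₁ refl
both-recoloured⇒two-step _   _   by-wFirst            = inj₂ refl

recolour-v : ∀ {k} {a b c : Fin k} → DiffAtMostOne (a ∷ b ∷ []) (c ∷ b ∷ [])
recolour-v = 0F , λ { 0F 0≢0 → ⊥-elim (0≢0 refl) ; 1F _ → refl }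

recolour-w : ∀ {k} {a b d : Fin k} → DiffAtMostOne (a ∷ b ∷ []) (a ∷ d ∷ [])
recolour-w = 1F , λ { 0F _ → refl ; 1F 1≢1 → ⊥-elim (1≢1 refl) }

≢-at-v : ∀ {k} {a b c d : Fin k} → a ≢ c → (a ∷ b ∷ []) ≢ (c ∷ d ∷ [])
≢-at-v a≢c = a≢c ∘ ∷-injectiveˡ

≢-at-w : ∀ {k} {a b c d : Fin k} → b ≢ d → (a ∷ b ∷ []) ≢ (c ∷ d ∷ [])
≢-at-w b≢d = b≢d ∘ ∷-injectiveˡ ∘ ∷-injectiveʳ

stay-irredundant : ∀ {k} (f : Col k) → IsIrredundant f f (f ∷ [])
stay-irredundant f = refl , refl , [-] , λ u → 1 , ℕ.≤-refl , λ { 0F → (λ _ → refl) , (λ ()) }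

direct-irredundant : ∀ {k} {f g : Col k} → DiffAtMostOne f g → f ≢ g → IsIrredundant f g (f ∷ g ∷ [])
direct-irredundant f≈g f≢g = refl , refl , (f≈g , f≢g) ∷ [-] , λ u → 1 , s≤s z≤n ,
  λ { 0F → (λ _ → refl) , (λ ()) ; 1F → (λ { (s≤s ()) }) , (λ _ → refl) }

vFirst-irredundant : ∀ {k} {a b c d : Fin k} → a ≢ c → b ≢ d → IsIrredundant (a ∷ b ∷ []) (c ∷ d ∷ []) (vFirst a b c d)
vFirst-irredundant a≢c b≢d = refl , refl , (recolour-v , ≢-at-v a≢c) ∷ (recolour-w , ≢-at-w b≢d) ∷ [-] ,
  λ { 0F → 1 , s≤s z≤n , λ { 0F → (λ _ → refl) , (λ ()) ; 1F → (λ { (s≤s ()) }) , (λ _ → refl)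
                           ; 2F → (λ { (s≤s ()) }) , (λ _ → refl) }
    ; 1F → 2 , s≤s (s≤s z≤n) , λ { 0F → (λ _ → refl) , (λ ()) ; 1F → (λ _ → refl) , (λ { (s≤s ()) })
                                ; 2F → (λ { (s≤s (s≤s ())) }) , (λ _ → refl) } }

wFirst-irredundant : ∀ {k} {a b c d : Fin k} → a ≢ c → b ≢ d → IsIrredundant (a ∷ b ∷ []) (c ∷ d ∷ []) (wFirst a b c d)
wFirst-irredundant a≢c b≢d = refl , refl , (recolour-w , ≢-at-w b≢d) ∷ (recolour-v , ≢-at-v a≢c) ∷ [-] ,
  λ { 1F → 1 , s≤s z≤n , λ { 0F → (λ _ → refl) , (λ ()) ; 1F → (λ { (s≤s ()) }) , (λ _ → refl)
                           ; 2F → (λ { (s≤s ()) }) , (λ _ → refl) }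
    ; 0F → 2 , s≤s (s≤s z≤n) , λ { 0F → (λ _ → refl) , (λ ()) ; 1F → (λ _ → refl) , (λ { (s≤s ()) })
                                ; 2F → (λ { (s≤s (s≤s ())) }) , (λ _ → refl) } }

irredundant-exists : ∀ {k} (f g : Col k) → ∃ (IsIrredundant f g)
irredundant-exists (a ∷ b ∷ []) (c ∷ d ∷ []) with a Fin.≟ c | b Fin.≟ d
... | yes refl | yes refl = _ , stay-irredundant (a ∷ b ∷ [])
... | yes refl | no b≢d   = _ , direct-irredundant recolour-w (≢-at-w b≢d)
... | no a≢c   | yes refl = _ , direct-irredundant recolour-v (≢-at-v a≢c)
... | no a≢c   | no b≢d   = _ , vFirst-irredundant a≢c b≢d

length-≤2 : ∀ {A : Set} {r r' : A} (xs : List A) → Unique xs → All (λ x → x ≡ r ⊎ x ≡ r') xs → length xs ≤ 2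
length-≤2 []               _ _ = z≤n
length-≤2 (_ ∷ [])         _ _ = s≤s z≤n
length-≤2 (_ ∷ _ ∷ [])     _ _ = s≤s (s≤s z≤n)
length-≤2 {r = r} {r'} (x ∷ y ∷ z ∷ _) ((x≢y ∷ x≢z ∷ _) ∷ (y≢z ∷ _) ∷ _) (x≈ ∷ y≈ ∷ z≈ ∷ _) = ⊥-elim (pigeonhole x≈ y≈ z≈)
  where
  pigeonhole : x ≡ r ⊎ x ≡ r' → y ≡ r ⊎ y ≡ r' → z ≡ r ⊎ z ≡ r' → ⊥
  pigeonhole (inj₁ refl) (inj₁ refl) _           = x≢y refl
  pigeonhole (inj₂ refl) (inj₂ refl) _           = x≢y refl
  pigeonhole (inj₁ refl) (inj₂ refl) (inj₁ refl) = x≢z refl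
  pigeonhole (inj₁ refl) (inj₂ refl) (inj₂ refl) = y≢z refl
  pigeonhole (inj₂ refl) (inj₁ refl) (inj₁ refl) = y≢z refl
  pigeonhole (inj₂ refl) (inj₁ refl) (inj₂ refl) = x≢z refl

∈⇒0<length : ∀ {A : Set} {x : A} {xs} → x ∈ xs → 0 < length xs
∈⇒0<length {xs = _ ∷ _} _ = s≤s z≤n

properOrders : ∀ {k} → Fin k → Fin k → Col k → ℕ
properOrders a b (c ∷ d ∷ []) = 𝟙 (avoids? c b d) ℕ.+ 𝟙 (avoids? d a c)

module FixedStart {k} {a b : Fin k} (a≢b : a ≢ b)
  (enum : Col k → List (List (Col k)))
  (enum-unique : ∀ F → Unique (enum F))
  (enum-complete : ∀ F s → (s ∈ enum F) ⇔ IsIrredundant (a ∷ b ∷ []) F s) where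

  properFraction : Col k → ℚ
  properFraction F = frac (length (filter allProper? (enum F))) (length (enum F))

  private
    ∈enum : ∀ {F s} → IsIrredundant (a ∷ b ∷ []) F s → s ∈ enum F
    ∈enum {F} {s} = Equivalence.from (enum-complete F s)

    route : ∀ {F s} → s ∈ enum F → Route (a ∷ b ∷ []) F s
    route {F} {s} = irredundant⇒Route ∘ Equivalence.to (enum-complete F s)

  enum-nonempty : ∀ F → 0 < length (enum F)
  enum-nonempty F = ∈⇒0<length (∈enum (proj₂ (irredundant-exists (a ∷ b ∷ []) F)))

  all-proper⇒one : ∀ F → (∀ {s} → s ∈ enum F → AllProper s) → frac 2 2 ≤ℚ properFraction F
  all-proper⇒one F all-proper = frac-≤ 2 2 _ _ (s≤s z≤n) (enum-nonempty F) (ℕ.≤-reflexive (begin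
    2 ℕ.* length (enum F)                          ≡⟨ ℕ.*-comm 2 (length (enum F)) ⟩
    length (enum F) ℕ.* 2                          ≡⟨ cong (λ xs → length xs ℕ.* 2) (List.filter-all allProper? (All.tabulate all-proper)) ⟨
    length (filter allProper? (enum F)) ℕ.* 2       ∎))
    where open ≡-Reasoning

  one-proper⇒half : ∀ F {r r'} → r ∈ enum F → AllProper r → (∀ {s} → s ∈ enum F → s ≡ r ⊎ s ≡ r') →
    frac 1 2 ≤ℚ properFraction F
  one-proper⇒half F r∈ r-proper only-r-r' = frac-≤ 1 2 _ _ (s≤s z≤n) (enum-nonempty F) (begin
    1 ℕ.* length (enum F)                     ≡⟨ ℕ.*-identityˡ _ ⟩
    length (enum F)                           ≤⟨ length-≤2 (enum F) (enum-unique F) (All.tabulate only-r-r') ⟩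
    1 ℕ.* 2                                   ≤⟨ ℕ.*-monoˡ-≤ 2 (∈⇒0<length (∈-filter⁺ allProper? r∈ r-proper)) ⟩
    length (filter allProper? (enum F)) ℕ.* 2  ∎)
    where open ℕ.≤-Reasoning

  properOrders≤properFraction : ∀ F → frac (properOrders a b F) 2 ≤ℚ properFraction F
  properOrders≤properFraction F@(c ∷ d ∷ []) = by-cases (avoids? c b d) (avoids? d a c)
    where
    by-cases : (v? : Dec (Avoids c b d)) (w? : Dec (Avoids d a c)) → frac (𝟙 v? ℕ.+ 𝟙 w?) 2 ≤ℚ properFraction F
    by-cases (yes v) (yes w) = all-proper⇒one F (λ s∈ → route-allProper (route s∈) a≢b v w)
    by-cases (yes (c≢b , c≢d)) (no ¬w) =
      one-proper⇒half F (∈enum (vFirst-irredundant a≢c b≢d)) (a≢b ∷ c≢b ∷ c≢d ∷ [])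
        (both-recoloured⇒two-step a≢c b≢d ∘ route)
      where
      d≡a : d ≡ a
      d≡a = decidable-stable (d Fin.≟ a) (λ d≢a → ¬w (d≢a , ≢-sym c≢d))
      a≢c : a ≢ c
      a≢c a≡c = c≢d (trans (sym a≡c) (sym d≡a))
      b≢d : b ≢ d
      b≢d b≡d = a≢b (trans (sym d≡a) (sym b≡d))
    by-cases (no ¬v) (yes (d≢a , d≢c)) =
      one-proper⇒half F (∈enum (wFirst-irredundant a≢c b≢d)) (a≢b ∷ ≢-sym d≢a ∷ ≢-sym d≢c ∷ [])
        (swap ∘ both-recoloured⇒two-step a≢c b≢d ∘ route)
      where
      c≡b : c ≡ b
      c≡b = decidable-stable (c Fin.≟ b) (λ c≢b → ¬v (c≢b , ≢-sym d≢c))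
      a≢c : a ≢ c
      a≢c a≡c = a≢b (trans a≡c c≡b)
      b≢d : b ≢ d
      b≢d b≡d = d≢c (trans (sym b≡d) (sym c≡b))
    by-cases (no _) (no _) = frac-≤ 0 2 _ _ (s≤s z≤n) (enum-nonempty F) z≤n

sum-properOrders : ∀ {n} (a b : Fin (suc n)) → sum (map (properOrders a b) (allCol (suc n))) ≡ n ℕ.* n ℕ.+ n ℕ.* n
sum-properOrders {n} a b = begin
  sum (map (properOrders a b) (allCol (suc n)))                                  ≡⟨ sum-allCol (properOrders a b) ⟩
  ∑[ c < suc n ] ∑[ d < suc n ] (𝟙 (avoids? c b d) ℕ.+ 𝟙 (avoids? d a c))         ≡⟨ sum-cong-≗ (λ c → ∑-distrib-+ (λ d → 𝟙 (avoids? c b d)) (λ d → 𝟙 (avoids? d a c))) ⟩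
  ∑[ c < suc n ] (∑[ d < suc n ] 𝟙 (avoids? c b d) ℕ.+ ∑[ d < suc n ] 𝟙 (avoids? d a c)) ≡⟨ ∑-distrib-+ (λ c → ∑[ d < suc n ] 𝟙 (avoids? c b d)) (λ c → ∑[ d < suc n ] 𝟙 (avoids? d a c)) ⟩
  ∑[ c < suc n ] ∑[ d < suc n ] 𝟙 (avoids? c b d) ℕ.+ ∑[ c < suc n ] ∑[ d < suc n ] 𝟙 (avoids? d a c)
    ≡⟨ cong₂ ℕ._+_ (∑∑-avoids b) (trans (∑-comm (λ c d → 𝟙 (avoids? d a c))) (∑∑-avoids a)) ⟩
  n ℕ.* n ℕ.+ n ℕ.* n                                                          ∎
  where open ≡-Reasoning

lemma6p4 : (k : ℕ) → 2 ≤ k → (fstart : Col k) → lookup fstart 0F ≢ lookup fstart 1F →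
    (enum : Col k → List (List (Col k))) →
    (∀ F → Unique (enum F)) →
    (∀ F (s : List (Col k)) → (s ∈ enum F) ⇔ IsIrredundant fstart F s) →
    ((1ℚ - frac 1 k) * (1ℚ - frac 1 k)) ≤ℚ probAllProper k enum
lemma6p4 (suc n) _ (a ∷ b ∷ []) a≢b enum enum-unique enum-complete = begin
  (1ℚ - frac 1 k) * (1ℚ - frac 1 k)                          ≡⟨ complement-square n ⟩
  frac 1 (k ℕ.* k) * frac (n ℕ.* n ℕ.+ n ℕ.* n) 2             ≤⟨ ℚ.*-monoˡ-≤-nonNeg (frac 1 (k ℕ.* k))
                                                                  {{ℚ.normalize-nonNeg 1 (k ℕ.* k)}} sum-bound ⟩
  frac 1 (k ℕ.* k) * sumℚ (map properFraction (allCol k))    ∎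
  where
  open ℚ.≤-Reasoning
  open FixedStart a≢b enum enum-unique enum-complete
  k : ℕ
  k = suc n
  sum-bound : frac (n ℕ.* n ℕ.+ n ℕ.* n) 2 ≤ℚ sumℚ (map properFraction (allCol k))
  sum-bound = begin
    frac (n ℕ.* n ℕ.+ n ℕ.* n) 2                              ≡⟨ cong (λ m → frac m 2) (sum-properOrders a b) ⟨
    frac (sum (map (properOrders a b) (allCol k))) 2           ≡⟨ sumℚ-frac (properOrders a b) 1 (allCol k) ⟨
    sumℚ (map (λ F → frac (properOrders a b F) 2) (allCol k))  ≤⟨ sumℚ-mono (allCol k) properOrders≤properFraction ⟩
    sumℚ (map properFraction (allCol k))                      ∎
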